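{- Let $\mathfrak{X}$ be an association scheme of rank $4$ and diameter $2$ with constituents ordered by degree, and suppose $k_2\le\varepsilon k_3/2$ for some $0<\varepsilon\le\frac1{100}$. Assume additionally that for some $0<\delta\le\frac1{100}$, $$p^2_{2,2}\ge\frac{1-\delta}{2}k_2\quad\text{and}\quad\frac18k_2\le p^1_{2,2}\le\frac13k_2.$$ Then $k_2\le20k_1$.
   Context: An association scheme of rank $r$ on a finite vertex set $V$ is a surjective map $c:V\times V\to\{0,1,\dots,r-1\}$ such that $c(u,v)=0$ iff $u=v$, $c(u,v)=c(v,u)$, and for all colors $i,j,t$ there is an integer $p^t_{i,j}$ such that whenever $c(u,v)=t$ there are exactly $p^t_{i,j}$ vertices $w$ with $c(u,w)=i$, $c(w,v)=j$. The constituent $X_i$ is the graph on $V$ with distinct $u,v$ adjacent iff $c(u,v)=i$; it is regular of degree $k_i=p^0_{i,i}$. The scheme has diameter $2$ if every $X_i$ ($i\ne0$) has diameter at most $2$ and some has diameter exactly $2$. Constituents are ordered by degree if $k_1\le k_2\le k_3$.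
   Formalization: The parameters ε and δ are taken to be rational. -}

module Defs where

open import Data.Nat using (ℕ)
open import Data.Empty using (⊥)
open import Data.Fin using (Fin; #_) renaming (_≟_ to _≟ᶠ_)
open import Data.List using (length; filter)
open import Data.List.Base using ()
open import Data.Fin.Base using ()
open import Data.Vec.Functional using ()
open import Data.Product using (Σ; ∃; _×_; _,_)
open import Data.Sum using (_⊎_)
open import Relation.Binary.PropositionalEquality using (_≡_; _≢_)
open import Relation.Nullary using (¬_; _×-dec_)
open import Data.List using (List)
import Data.Fin as F
import Data.List as L

allFin : (n : ℕ) → List (Fin n)
allFin n = L.tabulate (λ i → i)

countPaths : {n r : ℕ} → (Fin n → Fin n → Fin r) →
             Fin r → Fin r → Fin n → Fin n → ℕ
countPaths {n} c i j u v =
  length (filter (λ w → (c u w ≟ᶠ i) ×-dec (c w v ≟ᶠ j)) (allFin n))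

record AssocScheme′ (n m : ℕ) : Set where
  r : ℕ
  r = ℕ.suc m
  field
    col       : Fin n → Fin n → Fin r
    surj      : ∀ (i : Fin r) → ∃ λ u → ∃ λ v → col u v ≡ i
    col-zero₁ : ∀ u v → col u v ≡ F.zero → u ≡ v
    col-zero₂ : ∀ u → col u u ≡ F.zero
    symm      : ∀ u v → col u v ≡ col v u
    p         : Fin r → Fin r → Fin r → ℕ   -- p t i j  =  p^t_{i,j}
    p-spec    : ∀ t i j u v → col u v ≡ t → countPaths col i j u v ≡ p t i j

  k : Fin r → ℕ
  k i = p F.zero i i

  Adj : Fin r → Fin n → Fin n → Set
  Adj i u v = u ≢ v × col u v ≡ i

  DiamLe2 : Fin r → Set
  DiamLe2 i = ∀ u v → u ≡ v ⊎ (Adj i u v ⊎ ∃ λ w → Adj i u w × Adj i w v)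

  Diam2 : Fin r → Set
  Diam2 i = DiamLe2 i × (∃ λ u → ∃ λ v → u ≢ v × ¬ Adj i u v)

-- association scheme of rank r (r ≥ 1 forced since colour 0 exists)
AssocScheme : ℕ → ℕ → Set
AssocScheme n ℕ.zero    = ⊥
AssocScheme n (ℕ.suc m) = AssocScheme′ n m

HasDiameter2 : {n m : ℕ} → AssocScheme′ n m → Set
HasDiameter2 {n} {m} X =
  (∀ (i : Fin (ℕ.suc m)) → i ≢ F.zero → AssocScheme′.DiamLe2 X i) ×
  (∃ λ i → i ≢ F.zero × AssocScheme′.Diam2 X i)

module Submission where

-- Write K = k₂, a = p²₂₂, b = p¹₂₂, c = p³₂₂. Counting pairs (v, w) with v ∈ X₃(u) and
-- w ∈ X₂(u) ∩ X₂(v) gives c k₃ ≤ K², so c ≤ K/200. Now fix an X₁-edge ux and, for each of the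
-- b vertices w ∈ X₂(u) ∩ X₂(x), split the a vertices y ∈ X₂(u) ∩ X₂(w) by whether y ∈ X₃(x).
-- Summed over w, the first kind is counted at most c K times (each of the at most K such y
-- has only c common X₂-neighbours with x); the second kind lies in
-- X₂(u) ∖ X₃(x) ⊆ (X₂(u) ∩ X₂(x)) ∪ X₁(x), of size at most b + k₁. Hence a b ≤ c K + (b + k₁) b,
-- and with a ≥ 0.495 K, K/8 ≤ b ≤ K/3 and c ≤ K/200 this forces 73 K ≤ 600 k₁.

open import Defs

module Counting where
  open import Data.Nat using (ℕ; suc; _+_; _*_; _≤_; z≤n; s≤s)
  open import Data.Nat.Properties
  open import Data.Nat.ListAction using (sum)
  open import Data.List using (List; []; _∷_; length; filter; map)
  open import Data.List.Properties using (filter-≐; map-cong)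
  open import Data.List.Relation.Unary.All as All using (All; []; _∷_)
  open import Data.List.Relation.Binary.Sublist.Propositional using (⊆-refl)
  open import Data.List.Relation.Binary.Sublist.Propositional.Properties using (filter⁺; length-mono-≤)
  open import Data.Sum using (_⊎_; inj₁; inj₂)
  open import Level using (0ℓ)
  open import Relation.Nullary using (Dec; yes; no; _×-dec_; contradiction)
  open import Relation.Unary using (Pred; Decidable; _⊆_; _≐_)
  open import Relation.Binary.PropositionalEquality
  open import Algebra.Properties.CommutativeSemigroup +-commutativeSemigroup using (x∙yz≈y∙xz)

  𝟙 : {P : Set} → Dec P → ℕ
  𝟙 (yes _) = 1
  𝟙 (no _)  = 0

  module _ {A : Set} where

    count : {P : Pred A 0ℓ} → Decidable P → List A → ℕ
    count P? xs = length (filter P? xs)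

    ∑ : (A → ℕ) → List A → ℕ
    ∑ f xs = sum (map f xs)

    module _ {P Q : Pred A 0ℓ} (P? : Decidable P) (Q? : Decidable Q) where

      count-mono : P ⊆ Q → ∀ xs → count P? xs ≤ count Q? xs
      count-mono P⊆Q xs = length-mono-≤ (filter⁺ P? Q? (λ { refl → P⊆Q }) (⊆-refl {x = xs}))

      count-≐ : P ≐ Q → ∀ xs → count P? xs ≡ count Q? xs
      count-≐ P≐Q xs = cong length (filter-≐ P? Q? P≐Q xs)

      count-filter : ∀ xs → count Q? (filter P? xs) ≡ count (λ x → P? x ×-dec Q? x) xs
      count-filter [] = refl
      count-filter (x ∷ xs) with P? x
      ... | no _  = count-filter xs
      ... | yes _ with Q? x
      ...   | yes _ = cong suc (count-filter xs)
      ...   | no _  = count-filter xs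

    count-∑ : {P : Pred A 0ℓ} (P? : Decidable P) → ∀ xs → count P? xs ≡ ∑ (λ x → 𝟙 (P? x)) xs
    count-∑ P? [] = refl
    count-∑ P? (x ∷ xs) with P? x
    ... | yes _ = cong suc (count-∑ P? xs)
    ... | no _  = count-∑ P? xs

    ∑-mono-≤ : {f g : A → ℕ} {xs : List A} → All (λ x → f x ≤ g x) xs → ∑ f xs ≤ ∑ g xs
    ∑-mono-≤ []            = z≤n
    ∑-mono-≤ (fx≤gx ∷ le) = +-mono-≤ fx≤gx (∑-mono-≤ le)

    ∑-distrib-+ : (f g : A → ℕ) → ∀ xs → ∑ (λ x → f x + g x) xs ≡ ∑ f xs + ∑ g xs
    ∑-distrib-+ f g []       = refl
    ∑-distrib-+ f g (x ∷ xs) = begin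
      f x + g x + ∑ (λ x → f x + g x) xs  ≡⟨ cong (f x + g x +_) (∑-distrib-+ f g xs) ⟩
      f x + g x + (∑ f xs + ∑ g xs)       ≡⟨ +-assoc (f x) (g x) _ ⟩
      f x + (g x + (∑ f xs + ∑ g xs))     ≡⟨ cong (f x +_) (x∙yz≈y∙xz (g x) (∑ f xs) (∑ g xs)) ⟩
      f x + (∑ f xs + (g x + ∑ g xs))     ≡⟨ +-assoc (f x) (∑ f xs) _ ⟨
      f x + ∑ f xs + (g x + ∑ g xs)       ∎
      where open ≡-Reasoning

    ∑-const : {f : A → ℕ} {c : ℕ} {xs : List A} → All (λ x → f x ≡ c) xs → ∑ f xs ≡ c * length xs
    ∑-const {c = c} []                     = sym (*-zeroʳ c)
    ∑-const {c = c} {_ ∷ xs} (fx≡c ∷ eq) = trans (cong₂ _+_ fx≡c (∑-const eq)) (sym (*-suc c (length xs)))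

    ∑-bounded : {f : A → ℕ} {c : ℕ} {xs : List A} → All (λ x → f x ≤ c) xs → ∑ f xs ≤ c * length xs
    ∑-bounded []          = z≤n
    ∑-bounded {c = c} {_ ∷ xs} (fx≤c ∷ le) =
      ≤-trans (+-mono-≤ fx≤c (∑-bounded le)) (≤-reflexive (sym (*-suc c (length xs))))

  module _ {A B : Set} where

    ∑-comm : (f : A → B → ℕ) → ∀ xs ys → ∑ (λ x → ∑ (f x) ys) xs ≡ ∑ (λ y → ∑ (λ x → f x y) xs) ys
    ∑-comm f []       ys = sym (∑-const (All.universal (λ _ → refl) ys))
    ∑-comm f (x ∷ xs) ys =
      trans (cong (∑ (f x) ys +_) (∑-comm f xs ys)) (sym (∑-distrib-+ (f x) _ ys))

    count-swap : {R : A → B → Set} (R? : ∀ x y → Dec (R x y)) → ∀ xs ys →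
                 ∑ (λ x → count (R? x) ys) xs ≡ ∑ (λ y → count (λ x → R? x y) xs) ys
    count-swap R? xs ys = begin
      ∑ (λ x → count (R? x) ys) xs                ≡⟨ cong sum (map-cong (λ x → count-∑ (R? x) ys) xs) ⟩
      ∑ (λ x → ∑ (λ y → 𝟙 (R? x y)) ys) xs       ≡⟨ ∑-comm (λ x y → 𝟙 (R? x y)) xs ys ⟩
      ∑ (λ y → ∑ (λ x → 𝟙 (R? x y)) xs) ys       ≡⟨ cong sum (map-cong (λ y → count-∑ (λ x → R? x y) xs) ys) ⟨
      ∑ (λ y → count (λ x → R? x y) xs) ys        ∎
      where open ≡-Reasoning

  module _ {A : Set} {P Q R : Pred A 0ℓ} (P? : Decidable P) (Q? : Decidable Q) (R? : Decidable R)
           (split : ∀ {x} → P x → Q x ⊎ R x) where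

    𝟙-⊎ : ∀ x → 𝟙 (P? x) ≤ 𝟙 (Q? x) + 𝟙 (R? x)
    𝟙-⊎ x with P? x
    ... | no _  = z≤n
    ... | yes p with split p | Q? x | R? x
    ...   | inj₁ _ | yes _ | _     = s≤s z≤n
    ...   | inj₂ _ | _     | yes _ = m≤n+m 1 _
    ...   | inj₁ q | no ¬q | _     = contradiction q ¬q
    ...   | inj₂ r | _     | no ¬r = contradiction r ¬r

    count-⊎ : ∀ xs → count P? xs ≤ count Q? xs + count R? xs
    count-⊎ xs = begin
      count P? xs                                      ≡⟨ count-∑ P? xs ⟩
      ∑ (λ x → 𝟙 (P? x)) xs                          ≤⟨ ∑-mono-≤ (All.universal 𝟙-⊎ xs) ⟩
      ∑ (λ x → 𝟙 (Q? x) + 𝟙 (R? x)) xs               ≡⟨ ∑-distrib-+ _ _ xs ⟩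
      ∑ (λ x → 𝟙 (Q? x)) xs + ∑ (λ x → 𝟙 (R? x)) xs ≡⟨ cong₂ _+_ (count-∑ Q? xs) (count-∑ R? xs) ⟨
      count Q? xs + count R? xs                        ∎
      where open ≤-Reasoning

module AssociationSchemes where
  open import Data.Nat using (ℕ; zero; suc; _+_; _*_; _≤_)
  open import Data.Nat.Properties hiding (_≟_)
  open import Data.Fin using (Fin; zero; suc; _≟_; #_)
  open import Data.List using (List; length; filter)
  open import Data.List.Relation.Unary.All as All using ()
  open import Data.List.Relation.Unary.All.Properties using (all-filter)
  open import Data.Product using (_×_; _,_; proj₁; proj₂)
  open import Data.Sum using (_⊎_; inj₁; inj₂)
  open import Relation.Nullary using (yes; no; _×-dec_; contradiction)
  open import Relation.Nullary.Decidable using (¬?)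
  open import Relation.Binary.PropositionalEquality
  open Counting

  module Scheme {n m : ℕ} (X : AssocScheme′ n m) where
    open AssocScheme′ X

    V : List (Fin n)
    V = allFin n

    degree : ∀ i u → count (λ w → col u w ≟ i) V ≡ k i
    degree i u = trans (count-≐ (λ w → col u w ≟ i) (λ w → (col u w ≟ i) ×-dec (col w u ≟ i))
                                  ((λ {w} uw → uw , trans (symm w u) uw) , proj₁) V)
                       (p-spec zero i i u u (col-zero₂ u))

    degree′ : ∀ i u → count (λ w → col w u ≟ i) V ≡ k i
    degree′ i u = trans (count-≐ (λ w → col w u ≟ i) (λ w → col u w ≟ i)
                                   ((λ {w} wu → trans (symm u w) wu) , (λ {w} uw → trans (symm w u) uw)) V)
                        (degree i u)

    intersection-bound : ∀ t i j → p t i j * k t ≤ k i * k j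
    intersection-bound t i j with surj t
    ... | u , _ = begin
      p t i j * k t                               ≡⟨ cong (p t i j *_) (degree t u) ⟨
      p t i j * length Xₜ                         ≡⟨ ∑-const (All.map walks (all-filter _ V)) ⟨
      ∑ (λ v → count (λ w → col w v ≟ j) Xᵢ) Xₜ  ≡⟨ count-swap (λ v w → col w v ≟ j) Xₜ Xᵢ ⟩
      ∑ (λ w → count (λ v → col w v ≟ j) Xₜ) Xᵢ  ≤⟨ ∑-bounded (All.universal degree-bound Xᵢ) ⟩
      k j * length Xᵢ                             ≡⟨ cong (k j *_) (degree i u) ⟩
      k j * k i                                   ≡⟨ *-comm (k j) (k i) ⟩
      k i * k j                                   ∎
      where
      open ≤-Reasoning
      Xₜ Xᵢ : List (Fin n)
      Xₜ = filter (λ v → col u v ≟ t) V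
      Xᵢ = filter (λ w → col u w ≟ i) V

      walks : ∀ {v} → col u v ≡ t → count (λ w → col w v ≟ j) Xᵢ ≡ p t i j
      walks {v} uv = trans (count-filter _ _ V) (p-spec t i j u v uv)

      degree-bound : ∀ w → count (λ v → col w v ≟ j) Xₜ ≤ k j
      degree-bound w = begin
        count (λ v → col w v ≟ j) Xₜ                          ≡⟨ count-filter _ _ V ⟩
        count (λ v → (col u v ≟ t) ×-dec (col w v ≟ j)) V    ≤⟨ count-mono _ _ proj₂ V ⟩
        count (λ v → col w v ≟ j) V                           ≡⟨ degree j w ⟩
        k j                                                   ∎

    module _ {u x : Fin n} (i t : Fin (suc m)) where
      private
        S Y : List (Fin n)
        S = filter (λ w → (col u w ≟ i) ×-dec (col w x ≟ i)) V
        Y = filter (λ y → (col u y ≟ i) ×-dec (col y x ≟ t)) V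
        ∣M∣ : ℕ
        ∣M∣ = count (λ y → (col u y ≟ i) ×-dec ¬? (col y x ≟ t)) V

        ∣Y∣≤kᵢ : length Y ≤ k i
        ∣Y∣≤kᵢ = ≤-trans (count-mono _ _ proj₁ V) (≤-reflexive (degree i u))

        split-walks : ∀ {w} → col u w ≡ i × col w x ≡ i → p i i i ≤ count (λ y → col y w ≟ i) Y + ∣M∣
        split-walks {w} (uw , _) = begin
          p i i i                                                              ≡⟨ p-spec i i i u w uw ⟨
          count (λ y → (col u y ≟ i) ×-dec (col y w ≟ i)) V                   ≤⟨ count-⊎ _ _ _ by-colour V ⟩
          count (λ y → ((col u y ≟ i) ×-dec (col y x ≟ t)) ×-dec (col y w ≟ i)) V + ∣M∣
                                                                               ≡⟨ cong (_+ ∣M∣) (count-filter _ _ V) ⟨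
          count (λ y → col y w ≟ i) Y + ∣M∣                                    ∎
          where
          open ≤-Reasoning
          by-colour : ∀ {y} → col u y ≡ i × col y w ≡ i →
                      ((col u y ≡ i × col y x ≡ t) × col y w ≡ i) ⊎ (col u y ≡ i × col y x ≢ t)
          by-colour {y} (uy , yw) with col y x ≟ t
          ... | yes yx = inj₁ ((uy , yx) , yw)
          ... | no yx  = inj₂ (uy , yx)

        walks-to-x : ∀ {y} → col u y ≡ i × col y x ≡ t → count (λ w → col y w ≟ i) S ≤ p t i i
        walks-to-x {y} (_ , yx) = begin
          count (λ w → col y w ≟ i) S                           ≡⟨ count-filter _ _ V ⟩
          count (λ w → ((col u w ≟ i) ×-dec (col w x ≟ i)) ×-dec (col y w ≟ i)) V
                                                                ≤⟨ count-mono _ _ (λ {w} ((_ , wx) , yw) →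
                                                                     trans (symm x w) wx , trans (symm w y) yw) V ⟩
          count (λ w → (col x w ≟ i) ×-dec (col w y ≟ i)) V    ≡⟨ p-spec t i i x y (trans (symm x y) yx) ⟩
          p t i i                                               ∎
          where open ≤-Reasoning

      pⁱᵢᵢ-bound : ∀ {s} → col u x ≡ s →
        p i i i * p s i i ≤ p t i i * k i + count (λ y → (col u y ≟ i) ×-dec ¬? (col y x ≟ t)) V * p s i i
      pⁱᵢᵢ-bound {s} ux = begin
        p i i i * p s i i                                  ≡⟨ cong (p i i i *_) (p-spec s i i u x ux) ⟨
        p i i i * length S                                 ≡⟨ ∑-const (All.universal (λ _ → refl) S) ⟨
        ∑ (λ _ → p i i i) S                                ≤⟨ ∑-mono-≤ (All.map split-walks (all-filter _ V)) ⟩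
        ∑ (λ w → count (λ y → col y w ≟ i) Y + ∣M∣) S      ≡⟨ ∑-distrib-+ _ _ S ⟩
        ∑ (λ w → count (λ y → col y w ≟ i) Y) S + ∑ (λ _ → ∣M∣) S
                                                           ≡⟨ cong₂ _+_ (count-swap (λ w y → col y w ≟ i) S Y)
                                                                        (∑-const (All.universal (λ _ → refl) S)) ⟩
        ∑ (λ y → count (λ w → col y w ≟ i) S) Y + ∣M∣ * length S
                                                           ≤⟨ +-monoˡ-≤ _ (∑-bounded (All.map walks-to-x (all-filter _ V))) ⟩
        p t i i * length Y + ∣M∣ * length S                ≤⟨ +-mono-≤ (*-monoʳ-≤ (p t i i) ∣Y∣≤kᵢ)
                                                                     (≤-reflexive (cong (∣M∣ *_) (p-spec s i i u x ux))) ⟩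
        p t i i * k i + ∣M∣ * p s i i                      ∎
        where open ≤-Reasoning

  module Rank4 {n : ℕ} (X : AssocScheme′ n 3) where
    open AssocScheme′ X
    open Scheme X

    off-X₃-bound : ∀ {u x} → col u x ≡ # 1 →
      count (λ y → (col u y ≟ # 2) ×-dec ¬? (col y x ≟ # 3)) V ≤ p (# 1) (# 2) (# 2) + k (# 1)
    off-X₃-bound {u} {x} ux = begin
      count (λ y → (col u y ≟ # 2) ×-dec ¬? (col y x ≟ # 3)) V   ≤⟨ count-⊎ _ _ _ by-colour V ⟩
      count (λ y → (col u y ≟ # 2) ×-dec (col y x ≟ # 2)) V + count (λ y → col y x ≟ # 1) V
                                                                 ≡⟨ cong₂ _+_ (p-spec _ _ _ u x ux) (degree′ (# 1) x) ⟩
      p (# 1) (# 2) (# 2) + k (# 1)                              ∎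
      where
      open ≤-Reasoning
      by-colour : ∀ {y} → col u y ≡ # 2 × col y x ≢ # 3 → (col u y ≡ # 2 × col y x ≡ # 2) ⊎ col y x ≡ # 1
      by-colour {y} (uy , y≢3) with col y x in yx
      -- colour 0 would make y = x, so col u x would be 2
      ... | zero                   with () ← trans (sym ux) (trans (cong (col u) (sym (col-zero₁ y x yx))) uy)
      ... | suc zero               = inj₂ refl
      ... | suc (suc zero)         = inj₁ (uy , refl)
      ... | suc (suc (suc zero))   = contradiction refl y≢3

    p²₂₂-bound : ∀ {u x} → col u x ≡ # 1 →
      let a = p (# 2) (# 2) (# 2); b = p (# 1) (# 2) (# 2) in
      a * b ≤ p (# 3) (# 2) (# 2) * k (# 2) + (b + k (# 1)) * b
    p²₂₂-bound ux = ≤-trans (pⁱᵢᵢ-bound (# 2) (# 3) ux) (+-monoʳ-≤ _ (*-monoˡ-≤ _ (off-X₃-bound ux)))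

module Arithmetic where
  open import Data.Nat using (zero; suc; _+_; _*_; _≤_; z≤n; NonZero)
  open import Data.Nat.Properties
  open import Data.Nat.Tactic.RingSolver using (solve)
  open import Data.List using ([]; _∷_)
  open import Relation.Binary.PropositionalEquality

  73K≤600k₁ : ∀ K a b c k₁ k₃ .{{_ : NonZero K}} .{{_ : NonZero b}} →
    a * b ≤ c * K + (b + k₁) * b → c * k₃ ≤ K * K →
    K * 200 ≤ k₃ → 99 * K ≤ a * 200 → K ≤ b * 8 → b * 3 ≤ K → 73 * K ≤ 600 * k₁
  73K≤600k₁ K a b c k₁ k₃ ab≤ ck₃≤K² 200K≤k₃ 99K≤200a K≤8b 3b≤K =
    *-cancelˡ-≤ b (+-cancelˡ-≤ (224 * (b * K)) _ _ (begin
      224 * (b * K) + b * (73 * K)                              ≡⟨ solve (b ∷ K ∷ []) ⟩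
      (3 * b) * (99 * K)                                        ≤⟨ *-monoʳ-≤ (3 * b) 99K≤200a ⟩
      (3 * b) * (a * 200)                                       ≡⟨ solve (b ∷ a ∷ []) ⟩
      600 * (a * b)                                             ≤⟨ *-monoʳ-≤ 600 ab≤ ⟩
      600 * (c * K + (b + k₁) * b)                              ≡⟨ solve (c ∷ K ∷ b ∷ k₁ ∷ []) ⟩
      (3 * K) * (200 * c) + (200 * b) * (b * 3) + b * (600 * k₁)
          ≤⟨ +-monoˡ-≤ _ (+-mono-≤ (*-monoʳ-≤ (3 * K) (≤-trans 200c≤K K≤8b)) (*-monoʳ-≤ (200 * b) 3b≤K)) ⟩
      (3 * K) * (b * 8) + (200 * b) * K + b * (600 * k₁)        ≡⟨ solve (K ∷ b ∷ k₁ ∷ []) ⟩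
      224 * (b * K) + b * (600 * k₁)                            ∎))
    where
    open ≤-Reasoning
    200c≤K : 200 * c ≤ K
    200c≤K = *-cancelˡ-≤ K (begin
      K * (200 * c)  ≡⟨ solve (K ∷ c ∷ []) ⟩
      c * (K * 200)  ≤⟨ *-monoʳ-≤ c 200K≤k₃ ⟩
      c * k₃         ≤⟨ ck₃≤K² ⟩
      K * K          ∎)

  degree-ratio-bound : ∀ K a b c k₁ k₃ →
    a * b ≤ c * K + (b + k₁) * b → c * k₃ ≤ K * K →
    K * 200 ≤ k₃ → 99 * K ≤ a * 200 → K ≤ b * 8 → b * 3 ≤ K → K ≤ 20 * k₁
  degree-ratio-bound zero      _ _    _ _  _  _ _ _ _ _  _ = z≤n
  degree-ratio-bound (suc _)   _ zero _ _  _  _ _ _ _ () _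
  degree-ratio-bound K@(suc _) a b@(suc _) c k₁ k₃ h₁ h₂ h₃ h₄ h₅ h₆ = *-cancelˡ-≤ 73 (begin
    73 * K          ≤⟨ 73K≤600k₁ K a b c k₁ k₃ h₁ h₂ h₃ h₄ h₅ h₆ ⟩
    600 * k₁        ≤⟨ *-monoˡ-≤ k₁ (m≤m+n 600 860) ⟩
    1460 * k₁       ≡⟨ *-assoc 73 20 k₁ ⟩
    73 * (20 * k₁)  ∎)
    where open ≤-Reasoning

module Fractions where
  open import Data.Nat as ℕ using (suc)
  import Data.Nat.Properties as ℕ
  open import Data.Integer as ℤ using (+_)
  import Data.Integer.Properties as ℤ
  open import Data.Rational using (_/_; _≤_; _*_; _-_; 1ℚ; toℚᵘ)
  open import Data.Rational.Properties
  open import Data.Rational.Unnormalised as ℚᵘ using (mkℚᵘ; *≤*)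
  import Data.Rational.Unnormalised.Properties as ℚᵘ
  open import Relation.Binary.PropositionalEquality

  toℚᵘ-/ : ∀ m d → toℚᵘ (+ m / suc d) ℚᵘ.≃ mkℚᵘ (+ m) d
  toℚᵘ-/ m d = toℚᵘ-fromℚᵘ (mkℚᵘ (+ m) d)

  /≤/⇒*≤* : ∀ m d n e → + m / suc d ≤ + n / suc e → m ℕ.* suc e ℕ.≤ n ℕ.* suc d
  /≤/⇒*≤* m d n e m/d≤n/e
    with *≤* q ← ℚᵘ.≤-respˡ-≃ (toℚᵘ-/ m d) (ℚᵘ.≤-respʳ-≃ (toℚᵘ-/ n e) (toℚᵘ-mono-≤ m/d≤n/e))
    = ℤ.drop‿+≤+ (subst₂ ℤ._≤_ (sym (ℤ.pos-* m (suc e))) (sym (ℤ.pos-* n (suc d))) q)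

  /≤ℕ⇒≤* : ∀ m d n → + m / suc d ≤ + n / 1 → m ℕ.≤ n ℕ.* suc d
  /≤ℕ⇒≤* m d n h = subst (ℕ._≤ n ℕ.* suc d) (ℕ.*-identityʳ m) (/≤/⇒*≤* m d n 0 h)

  ℕ≤/⇒*≤ : ∀ m n e → + m / 1 ≤ + n / suc e → m ℕ.* suc e ℕ.≤ n
  ℕ≤/⇒*≤ m n e h = subst (m ℕ.* suc e ℕ.≤_) (ℕ.*-identityʳ n) (/≤/⇒*≤* m 0 n e h)

  /-*-/ : ∀ m d n e → (+ m / suc d) * (+ n / suc e) ≡ + (m ℕ.* n) / (suc d ℕ.* suc e)
  /-*-/ m d n e = toℚᵘ-injective (begin
    toℚᵘ ((+ m / suc d) * (+ n / suc e))        ≈⟨ toℚᵘ-homo-* (+ m / suc d) (+ n / suc e) ⟩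
    toℚᵘ (+ m / suc d) ℚᵘ.* toℚᵘ (+ n / suc e)  ≈⟨ ℚᵘ.*-cong (toℚᵘ-/ m d) (toℚᵘ-/ n e) ⟩
    mkℚᵘ (+ m ℤ.* + n) _                         ≡⟨ cong (λ z → mkℚᵘ z _) (ℤ.pos-* m n) ⟨
    mkℚᵘ (+ (m ℕ.* n)) _                         ≈⟨ toℚᵘ-/ (m ℕ.* n) _ ⟨
    toℚᵘ (+ (m ℕ.* n) / (suc d ℕ.* suc e))       ∎)
    where open ℚᵘ.≃-Reasoning

  ℕ≤ε*/⇒*≤ : ∀ {ε} m n d e → ε ≤ + 1 / suc d → + m / 1 ≤ ε * (+ n / suc e) →
             m ℕ.* (suc d ℕ.* suc e) ℕ.≤ n
  ℕ≤ε*/⇒*≤ {ε} m n d e ε≤1/d m≤εn/e =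
    ℕ.≤-trans (ℕ≤/⇒*≤ m (1 ℕ.* n) _ (subst (+ m / 1 ≤_) (/-*-/ 1 d n e) m≤n/de)) (ℕ.≤-reflexive (ℕ.*-identityˡ n))
    where
    m≤n/de : + m / 1 ≤ (+ 1 / suc d) * (+ n / suc e)
    m≤n/de = ≤-trans m≤εn/e (*-monoʳ-≤-nonNeg (+ n / suc e) {{normalize-nonNeg n (suc e)}} ε≤1/d)

  [1-δ]*/≤ℕ⇒*≤* : ∀ {δ} m n e → δ ≤ + 1 / 100 → (1ℚ - δ) * (+ n / suc e) ≤ + m / 1 →
                  99 ℕ.* n ℕ.≤ m ℕ.* (100 ℕ.* suc e)
  [1-δ]*/≤ℕ⇒*≤* {δ} m n e δ≤1/100 [1-δ]n/e≤m =
    /≤ℕ⇒≤* (99 ℕ.* n) _ m (subst (_≤ + m / 1) (/-*-/ 99 99 n e) 99n/100e≤m)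
    where
    -- 1ℚ - + 1 / 100 computes to + 99 / 100
    99n/100e≤m : (+ 99 / 100) * (+ n / suc e) ≤ + m / 1
    99n/100e≤m = ≤-trans (*-monoʳ-≤-nonNeg (+ n / suc e) {{normalize-nonNeg n (suc e)}}
                           (+-monoʳ-≤ 1ℚ (neg-antimono-≤ δ≤1/100)))
                         [1-δ]n/e≤m

open import Data.Nat using (ℕ)
open import Data.Fin using (#_)
open import Data.Integer using (+_)
open import Data.Rational using (ℚ; _/_; _≤_; _<_; _*_; _-_; 0ℚ; 1ℚ)
open import Data.Product using (_,_)
import Data.Nat as N
open AssociationSchemes using (module Scheme; module Rank4)
open Arithmetic using (degree-ratio-bound)
open Fractions using (/≤ℕ⇒≤*; ℕ≤/⇒*≤; ℕ≤ε*/⇒*≤; [1-δ]*/≤ℕ⇒*≤*)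

lemma5p6 : ∀ {n : ℕ} (X : AssocScheme n 4) → HasDiameter2 X →
    let open AssocScheme′ X in
    k (# 1) N.≤ k (# 2) → k (# 2) N.≤ k (# 3) →
    ∀ (ε δ : ℚ) → 0ℚ < ε → ε ≤ (+ 1 / 100) → 0ℚ < δ → δ ≤ (+ 1 / 100) →
    (+ k (# 2) / 1) ≤ ε * (+ k (# 3) / 2) →
    (1ℚ - δ) * (+ k (# 2) / 2) ≤ (+ p (# 2) (# 2) (# 2) / 1) →
    (+ k (# 2) / 8) ≤ (+ p (# 1) (# 2) (# 2) / 1) →
    (+ p (# 1) (# 2) (# 2) / 1) ≤ (+ k (# 2) / 3) →
    k (# 2) N.≤ 20 N.* k (# 1)
lemma5p6 X _ _ _ ε δ _ ε≤1/100 _ δ≤1/100 k₂≤εk₃/2 [1-δ]k₂/2≤a k₂/8≤b b≤k₂/3 =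
  let _ , _ , ux = surj (# 1) in
  degree-ratio-bound (k (# 2)) a b c (k (# 1)) (k (# 3))
    (p²₂₂-bound ux)
    (intersection-bound (# 3) (# 2) (# 2))
    (ℕ≤ε*/⇒*≤ (k (# 2)) (k (# 3)) 99 1 ε≤1/100 k₂≤εk₃/2)
    ([1-δ]*/≤ℕ⇒*≤* a (k (# 2)) 1 δ≤1/100 [1-δ]k₂/2≤a)
    (/≤ℕ⇒≤* (k (# 2)) 7 b k₂/8≤b)
    (ℕ≤/⇒*≤ b (k (# 2)) 2 b≤k₂/3)
  where
  open AssocScheme′ X
  open Scheme X
  open Rank4 X
  a b c : ℕ
  a = p (# 2) (# 2) (# 2)
  b = p (# 1) (# 2) (# 2)
  c = p (# 3) (# 2) (# 2)
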